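{- Let $T$ be a finite rooted ordered tree and consider $\mathrm{DFUDS}(T)$ as a bitvector. Let $i<j$ be positive integers such that $\mathsf{select}_0(j)$ exists. Then the following are equivalent: (i) $D[\mathsf{select}_0(i)]\le D[x]$ for all $x\in[\mathsf{select}_0(i+1),\mathsf{select}_0(j)]$; (ii) $\mathsf{rank}_0(\mathsf{open}(\mathsf{rmq}_D(\mathsf{select}_0(i+1),\mathsf{select}_0(j))))=i$.
   Context: $\mathrm{DFUDS}(T)$ is the parenthesis sequence consisting of a single '(' followed by the concatenation, over all nodes of $T$ in depth-first (pre)order, of $d$ copies of '(' and then one ')', where $d$ is the number of children of the node; it is balanced. It is viewed as a bitvector $B$ with '(' $=1$ and ')' $=0$, positions indexed from $1$. $\mathsf{rank}_0(x)$ / $\mathsf{rank}_1(x)$ is the number of $0$s / $1$s among $B[1],\ldots,B[x]$; $\mathsf{select}_0(k)$ is the position of the $k$-th $0$. $\mathsf{open}(x)$, for a position $x$ with $B[x]=0$, is the position of the matching '(' in the balanced sequence. $D[x]:=\mathsf{rank}_1(x)-\mathsf{rank}_0(x)$, and $\mathsf{rmq}_D(a,b)$ is the leftmost position in $[a,b]$ at which $D$ attains its minimum over $[a,b]$. -}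

module Defs where

open import Data.Bool using (Bool; true; false; if_then_else_)
open import Data.Nat using (ℕ; zero; suc; _+_; _∸_)
open import Data.List using (List; []; _∷_; _++_; length; replicate; take; reverse; map; upTo; concatMap)
open import Data.Integer using (ℤ; +_; _-_; _<?_)
open import Relation.Nullary using (does)

data Tree : Set where
  node : List Tree → Tree

-- Concatenation over all nodes in preorder of  (d copies of '(' then ')').
-- '(' = true (bit 1), ')' = false (bit 0).
dfudsBody : Tree → List Bool
dfudsForest : List Tree → List Bool

dfudsBody (node ts) = replicate (length ts) true ++ (false ∷ dfudsForest ts)

dfudsForest [] = []
dfudsForest (t ∷ ts) = dfudsBody t ++ dfudsForest ts

DFUDS : Tree → List Bool
DFUDS t = true ∷ dfudsBody t

-- Bitvector operations, positions indexed from 1.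
count : Bool → List Bool → ℕ
count b [] = 0
count true  (true  ∷ bs) = suc (count true bs)
count true  (false ∷ bs) = count true bs
count false (true  ∷ bs) = count false bs
count false (false ∷ bs) = suc (count false bs)

rank1 : List Bool → ℕ → ℕ
rank1 B x = count true (take x B)

rank0 : List Bool → ℕ → ℕ
rank0 B x = count false (take x B)

-- select0 B k = position (1-based) of the k-th 0 of B, for 1 ≤ k ≤ rank0 B (length B)
-- (the value returned otherwise is an irrelevant default).
select0 : List Bool → ℕ → ℕ
select0 [] k = 0
select0 (true ∷ bs) k = suc (select0 bs k)
select0 (false ∷ bs) zero = 0
select0 (false ∷ bs) (suc zero) = 1
select0 (false ∷ bs) (suc (suc k)) = suc (select0 bs (suc k))

D : List Bool → ℕ → ℤ
D B x = + rank1 B x - + rank0 B x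

-- open B x : for B[x] = ')', the position of the matching '('.
-- The argument list is the reversed prefix, so the head element of a list r'
-- sits at position length r'.
openScan : List Bool → ℕ → ℕ
openScan [] c = 0
openScan (false ∷ r) c = openScan r (suc c)
openScan (true ∷ r) zero = suc (length r)
openScan (true ∷ r) (suc c) = openScan r c

open′ : List Bool → ℕ → ℕ
open′ B x = openScan (reverse (take (x ∸ 1) B)) 0

range : ℕ → ℕ → List ℕ
range a b = map (λ k → a + k) (upTo (suc (b ∸ a)))

-- leftmost argmin of D over a list of positions (replace only on strict decrease)
argminD : List Bool → List ℕ → ℕ → ℕ
argminD B [] best = best
argminD B (x ∷ xs) best = if does (D B x <? D B best) then argminD B xs x else argminD B xs best

rmqD : List Bool → ℕ → ℕ → ℕ
rmqD B a b = argminD B (range a b) a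

-- Let s = select0 i and a = select0 (i+1). Between these two ')' there are only '(', so D climbs
-- by one per step from D[s] to D[a−1] = D[a] + 1. The leftmost minimum m of D on [a, select0 j]
-- is entered by a ')' and D > D[m] on [a−1, m), so open(m) is one past the nearest position left
-- of m where D equals D[m]. If D[s] ≤ D[m], that level is attained during the climb (a discrete
-- intermediate value argument), so open(m) lands in [s, a−1], which is exactly the set of
-- positions of rank0 i; conversely, if it lands there then D[m] = D[open(m) − 1] ≥ D[s].
module Submission where

open import Defs
open import Data.Nat using (ℕ; suc; _≤_; _<_)
open import Data.List using (length)
open import Data.Integer using () renaming (_≤_ to _≤ℤ_)
open import Relation.Binary.PropositionalEquality using (_≡_)
open import Function.Bundles using (_⇔_; mk⇔)

open import Data.Bool using (Bool; true; false)
open import Data.Nat using (zero; _+_; _∸_; z≤n; s≤s)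
import Data.Nat.Properties as ℕP
open import Data.Integer using (ℤ; +_; -_; _-_; 1ℤ; pred; _<?_; _≤?_)
  renaming (_+_ to _+ℤ_; _<_ to _<ℤ_; suc to sucℤ)
import Data.Integer.Properties as ℤP
open import Data.Integer.Tactic.RingSolver using (solve-∀)
open import Data.List using (List; []; _∷_; _++_; _∷ʳ_; take; reverse; applyUpTo; iterate)
import Data.List.Properties as LP
open import Data.Product using (∃; _×_; _,_; proj₁; proj₂)
open import Data.Sum using (inj₁; inj₂)
open import Function using (_∘_)
open import Function.Properties.Equivalence using () renaming (trans to ⇔-trans)
open import Relation.Nullary using (¬_; yes; no)
open import Relation.Binary.PropositionalEquality using (refl; sym; trans; cong; cong₂; subst; subst₂)
open import Data.Empty using (⊥-elim)

sucℤ-injective : ∀ {i j} → sucℤ i ≡ sucℤ j → i ≡ j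
sucℤ-injective {i} {j} eq = trans (sym (ℤP.pred-suc i)) (trans (cong pred eq) (ℤP.pred-suc j))

i<suc[i] : ∀ i → i <ℤ sucℤ i
i<suc[i] i = ℤP.suc[i]≤j⇒i<j ℤP.≤-refl

-- D B x unfolds to excess (take x B), so facts about excess transfer to D along take.
excess : List Bool → ℤ
excess xs = + count true xs - + count false xs

count-++ : ∀ b xs ys → count b (xs ++ ys) ≡ count b xs + count b ys
count-++ b     []           ys = refl
count-++ true  (true  ∷ xs) ys = cong suc (count-++ true xs ys)
count-++ true  (false ∷ xs) ys = count-++ true xs ys
count-++ false (true  ∷ xs) ys = count-++ false xs ys
count-++ false (false ∷ xs) ys = cong suc (count-++ false xs ys)

count-∷ʳ-same : ∀ b xs → count b (xs ∷ʳ b) ≡ suc (count b xs)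
count-∷ʳ-same true  xs = trans (count-++ true xs _) (ℕP.+-comm _ 1)
count-∷ʳ-same false xs = trans (count-++ false xs _) (ℕP.+-comm _ 1)

count-false-∷ʳ-true : ∀ xs → count false (xs ∷ʳ true) ≡ count false xs
count-false-∷ʳ-true xs = trans (count-++ false xs _) (ℕP.+-identityʳ _)

count-true-∷ʳ-false : ∀ xs → count true (xs ∷ʳ false) ≡ count true xs
count-true-∷ʳ-false xs = trans (count-++ true xs _) (ℕP.+-identityʳ _)

excess-∷ʳ-true : ∀ xs → excess (xs ∷ʳ true) ≡ sucℤ (excess xs)
excess-∷ʳ-true xs = trans
  (cong₂ (λ a b → + a - + b) (count-∷ʳ-same true xs) (count-false-∷ʳ-true xs))
  (ℤP.+-assoc 1ℤ (+ count true xs) (- + count false xs))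

excess-∷ʳ-false : ∀ xs → excess xs ≡ sucℤ (excess (xs ∷ʳ false))
excess-∷ʳ-false xs = trans (shift (+ count true xs) (+ count false xs))
  (sym (cong₂ (λ a b → sucℤ (+ a - + b)) (count-true-∷ʳ-false xs) (count-∷ʳ-same false xs)))
  where
  shift : ∀ a b → a - b ≡ + 1 +ℤ (a - (+ 1 +ℤ b))
  shift = solve-∀

data Next (B : List Bool) (x : ℕ) : Set where
  bit : ∀ b → x < length B → take (suc x) B ≡ take x B ∷ʳ b → Next B x
  end : length B ≤ x → take (suc x) B ≡ take x B → Next B x

next : ∀ B x → Next B x
next []       zero    = end z≤n refl
next []       (suc x) = end z≤n refl
next (b ∷ bs) zero    = bit b (s≤s z≤n) refl
next (b ∷ bs) (suc x) with next bs x
... | bit b′ x<n eq = bit b′ (s≤s x<n) (cong (b ∷_) eq)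
... | end n≤x eq    = end (s≤s n≤x) (cong (b ∷_) eq)

data Step (B : List Bool) (x : ℕ) : Set where
  up   : rank0 B (suc x) ≡ rank0 B x → D B (suc x) ≡ sucℤ (D B x) → Step B x
  down : x < length B → rank0 B (suc x) ≡ suc (rank0 B x) → D B x ≡ sucℤ (D B (suc x)) → Step B x
  flat : length B ≤ x → rank0 B (suc x) ≡ rank0 B x → D B (suc x) ≡ D B x → Step B x

step : ∀ B x → Step B x
step B x with next B x
... | bit true _ eq = up
  (trans (cong (count false) eq) (count-false-∷ʳ-true (take x B)))
  (trans (cong excess eq) (excess-∷ʳ-true (take x B)))
... | bit false x<n eq = down x<n
  (trans (cong (count false) eq) (count-∷ʳ-same false (take x B)))
  (trans (excess-∷ʳ-false (take x B)) (cong (sucℤ ∘ excess) (sym eq)))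
... | end n≤x eq = flat n≤x (cong (count false) eq) (cong excess eq)

rank0-mono : ∀ B {x y} → x ≤ y → rank0 B x ≤ rank0 B y
rank0-mono B            z≤n       = z≤n
rank0-mono []           (s≤s x≤y) = z≤n
rank0-mono (true ∷ bs)  (s≤s x≤y) = rank0-mono bs x≤y
rank0-mono (false ∷ bs) (s≤s x≤y) = s≤s (rank0-mono bs x≤y)

rank0-cancel-< : ∀ B {x y} → rank0 B x < rank0 B y → x < y
rank0-cancel-< B r<r = ℕP.≰⇒> (ℕP.<⇒≱ r<r ∘ rank0-mono B)

rank0-constant : ∀ B {a p y} → rank0 B a ≡ rank0 B p → a ≤ y → y ≤ p → rank0 B y ≡ rank0 B a
rank0-constant B ra≡rp a≤y y≤p =
  ℕP.≤-antisym (subst (_ ≤_) (sym ra≡rp) (rank0-mono B y≤p)) (rank0-mono B a≤y)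

D-up : ∀ B {x} → rank0 B (suc x) ≡ rank0 B x → x < length B → D B (suc x) ≡ sucℤ (D B x)
D-up B {x} r≡ x<n with step B x
... | up _ e = e
... | down _ r _ = ⊥-elim (ℕP.1+n≢n (trans (sym r) r≡))
... | flat n≤x _ _ = ⊥-elim (ℕP.<⇒≱ x<n n≤x)

D-down : ∀ B {x} → rank0 B (suc x) ≡ suc (rank0 B x) → x < length B × D B x ≡ sucℤ (D B (suc x))
D-down B {x} r≡ with step B x
... | up r _ = ⊥-elim (ℕP.1+n≢n (trans (sym r≡) r))
... | down x<n _ e = x<n , e
... | flat _ r _ = ⊥-elim (ℕP.1+n≢n (trans (sym r≡) r))

D-suc-≤ : ∀ B x → D B (suc x) ≤ℤ sucℤ (D B x)
D-suc-≤ B x with step B x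
... | up _ e = ℤP.≤-reflexive e
... | down _ _ e = ℤP.≤-trans (ℤP.i≤suc[i] _) (ℤP.≤-trans (ℤP.≤-reflexive (sym e)) (ℤP.i≤suc[i] _))
... | flat _ _ e = ℤP.≤-trans (ℤP.≤-reflexive e) (ℤP.i≤suc[i] _)

D-decrease : ∀ B x → D B (suc x) <ℤ D B x → D B x ≡ sucℤ (D B (suc x))
D-decrease B x lt with step B x
... | up _ e = ⊥-elim (ℤP.<-asym lt (subst (D B x <ℤ_) (sym e) (i<suc[i] _)))
... | down _ _ e = e
... | flat _ _ e = ⊥-elim (ℤP.<-irrefl e lt)

D-ascends-on-ones : ∀ B {a p} → rank0 B a ≡ rank0 B p → p ≤ length B
  → ∀ {y} → a ≤ y → y ≤ p → D B a ≤ℤ D B y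
D-ascends-on-ones B {a} {p} ra≡rp p≤n {y} a≤y y≤p with ℕP.m≤n⇒m<n∨m≡n a≤y
... | inj₂ refl = ℤP.≤-refl
D-ascends-on-ones B {a} {p} ra≡rp p≤n {suc y} a≤y y≤p | inj₁ (s≤s a≤y′) =
  ℤP.≤-trans (D-ascends-on-ones B ra≡rp p≤n a≤y′ (ℕP.<⇒≤ y≤p))
    (ℤP.≤-trans (ℤP.i≤suc[i] _) (ℤP.≤-reflexive (sym (D-up B ones (ℕP.<-≤-trans y≤p p≤n)))))
  where
  ones : rank0 B (suc y) ≡ rank0 B y
  ones = trans (rank0-constant B ra≡rp (ℕP.m≤n⇒m≤1+n a≤y′) y≤p)
               (sym (rank0-constant B ra≡rp a≤y′ (ℕP.<⇒≤ y≤p)))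

D-intermediate-value : ∀ B {a p v} → a ≤ p → D B a ≤ℤ v → v ≤ℤ D B p
  → ∃ λ y → a ≤ y × y ≤ p × D B y ≡ v
D-intermediate-value B {a} {p} {v} a≤p Da≤v v≤Dp with ℕP.m≤n⇒m<n∨m≡n a≤p
... | inj₂ refl = a , ℕP.≤-refl , ℕP.≤-refl , ℤP.≤-antisym Da≤v v≤Dp
D-intermediate-value B {a} {suc p} {v} a≤p Da≤v v≤Dp | inj₁ (s≤s a≤p′) with v ≤? D B p
... | yes v≤Dp′ with D-intermediate-value B a≤p′ Da≤v v≤Dp′
...   | y , a≤y , y≤p , Dy≡v = y , a≤y , ℕP.m≤n⇒m≤1+n y≤p , Dy≡v
D-intermediate-value B {a} {suc p} {v} a≤p Da≤v v≤Dp | inj₁ (s≤s a≤p′) | no v≰Dp′ =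
  suc p , a≤p , ℕP.≤-refl ,
  ℤP.≤-antisym (ℤP.≤-trans (D-suc-≤ B p) (ℤP.i<j⇒suc[i]≤j (ℤP.≰⇒> v≰Dp′))) v≤Dp

record LeftmostMin (f : ℕ → ℤ) (a b m : ℕ) : Set where
  field
    a≤m      : a ≤ m
    m≤b      : m ≤ b
    <-before : ∀ {y} → a ≤ y → y < m → f m <ℤ f y
    ≤-after  : ∀ {y} → m ≤ y → y ≤ b → f m ≤ℤ f y

  minimal : ∀ {y} → a ≤ y → y ≤ b → f m ≤ℤ f y
  minimal {y} a≤y y≤b with ℕP.<-≤-connex y m
  ... | inj₁ y<m = ℤP.<⇒≤ (<-before a≤y y<m)
  ... | inj₂ m≤y = ≤-after m≤y y≤b

  ≤-min⇔≤-all : ∀ {v} → (∀ x → a ≤ x → x ≤ b → v ≤ℤ f x) ⇔ v ≤ℤ f m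
  ≤-min⇔≤-all = mk⇔ (λ v≤all → v≤all m a≤m m≤b) (λ v≤fm x a≤x x≤b → ℤP.≤-trans v≤fm (minimal a≤x x≤b))

open LeftmostMin

leftmostMin-singleton : ∀ f a → LeftmostMin f a a a
leftmostMin-singleton f a = record
  { a≤m      = ℕP.≤-refl
  ; m≤b      = ℕP.≤-refl
  ; <-before = λ a≤y y<a → ⊥-elim (ℕP.<-irrefl refl (ℕP.≤-<-trans a≤y y<a))
  ; ≤-after  = λ a≤y y≤a → ℤP.≤-reflexive (cong _ (ℕP.≤-antisym a≤y y≤a))
  }

leftmostMin-extend-new : ∀ {f a b m} → LeftmostMin f a b m → f (suc b) <ℤ f m
  → LeftmostMin f a (suc b) (suc b)
leftmostMin-extend-new {f} {a} {b} {m} lm fb<fm = record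
  { a≤m      = ℕP.m≤n⇒m≤1+n (ℕP.≤-trans (a≤m lm) (m≤b lm))
  ; m≤b      = ℕP.≤-refl
  ; <-before = λ a≤y y≤b → ℤP.<-≤-trans fb<fm (minimal lm a≤y (ℕP.≤-pred y≤b))
  ; ≤-after  = λ b<y y≤b → ℤP.≤-reflexive (cong f (ℕP.≤-antisym b<y y≤b))
  }

leftmostMin-extend-old : ∀ {f a b m} → LeftmostMin f a b m → ¬ (f (suc b) <ℤ f m)
  → LeftmostMin f a (suc b) m
leftmostMin-extend-old {f} {a} {b} {m} lm fb≮fm = record
  { a≤m      = a≤m lm
  ; m≤b      = ℕP.m≤n⇒m≤1+n (m≤b lm)
  ; <-before = <-before lm
  ; ≤-after  = after
  }
  where
  after : ∀ {y} → m ≤ y → y ≤ suc b → f m ≤ℤ f y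
  after m≤y y≤b with ℕP.m≤n⇒m<n∨m≡n y≤b
  ... | inj₁ y<b = ≤-after lm m≤y (ℕP.≤-pred y<b)
  ... | inj₂ refl = ℤP.≮⇒≥ fb≮fm

argminD-leftmostMin : ∀ B n {a b m} → LeftmostMin (D B) a b m
  → LeftmostMin (D B) a (b + n) (argminD B (iterate suc (suc b) n) m)
argminD-leftmostMin B zero {b = b} lm rewrite ℕP.+-identityʳ b = lm
argminD-leftmostMin B (suc n) {b = b} {m} lm rewrite ℕP.+-suc b n with D B (suc b) <? D B m
... | yes lt = argminD-leftmostMin B n (leftmostMin-extend-new lm lt)
... | no ≮  = argminD-leftmostMin B n (leftmostMin-extend-old lm ≮)

applyUpTo-iterate : ∀ (f : ℕ → ℕ) a n → (∀ k → f k ≡ a + k) → applyUpTo f n ≡ iterate suc a n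
applyUpTo-iterate f a zero    f≗ = refl
applyUpTo-iterate f a (suc n) f≗ = cong₂ _∷_ (trans (f≗ 0) (ℕP.+-identityʳ a))
  (applyUpTo-iterate (f ∘ suc) (suc a) n (λ k → trans (f≗ (suc k)) (ℕP.+-suc a k)))

range≡iterate : ∀ a b → range a b ≡ iterate suc a (suc (b ∸ a))
range≡iterate a b = trans (LP.map-upTo (λ k → a + k) _) (applyUpTo-iterate (λ k → a + k) a _ (λ _ → refl))

rmqD-leftmostMin : ∀ B {a b} → a ≤ b → LeftmostMin (D B) a b (rmqD B a b)
rmqD-leftmostMin B {a} {b} a≤b =
  subst₂ (LeftmostMin (D B) a) (ℕP.m+[n∸m]≡n a≤b) (sym rmqD≡)
    (argminD-leftmostMin B (b ∸ a) (leftmostMin-singleton (D B) a))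
  where
  revisit-a : ∀ xs → argminD B (a ∷ xs) a ≡ argminD B xs a
  revisit-a xs with D B a <? D B a
  ... | yes _ = refl
  ... | no _  = refl
  rmqD≡ : rmqD B a b ≡ argminD B (iterate suc (suc a) (b ∸ a)) a
  rmqD≡ = trans (cong (λ xs → argminD B xs a) (range≡iterate a b)) (revisit-a (iterate suc (suc a) (b ∸ a)))

-- Having read c unmatched ')' left of position n, the scan looks for the nearest q′ < n with
-- D B q′ below the level t = D B n − c and returns q′ + 1 (or 0 if there is none); t stays fixed
-- as the scan moves left.
record Matching (B : List Bool) (n : ℕ) (t : ℤ) (q : ℕ) : Set where
  field
    q≤n   : q ≤ n
    above : ∀ {z} → q ≤ z → z ≤ n → t ≤ℤ D B z
    hit   : ∀ {q′} → q ≡ suc q′ → sucℤ (D B q′) ≡ t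

open Matching

matching-extend : ∀ {B n t q} → Matching B n t q → t ≤ℤ D B (suc n) → Matching B (suc n) t q
matching-extend {B} {n} {t} {q} mt t≤D = record
  { q≤n   = ℕP.m≤n⇒m≤1+n (q≤n mt)
  ; above = above′
  ; hit   = hit mt
  }
  where
  above′ : ∀ {z} → q ≤ z → z ≤ suc n → t ≤ℤ D B z
  above′ q≤z z≤1+n with ℕP.m≤n⇒m<n∨m≡n z≤1+n
  ... | inj₁ z<n  = above mt q≤z (ℕP.≤-pred z<n)
  ... | inj₂ refl = t≤D

i≡j+n⇒j≤i : ∀ {x t c} → x ≡ t +ℤ + c → t ≤ℤ x
i≡j+n⇒j≤i {t = t} {c} x≡ = ℤP.≤-trans (ℤP.i≤i+j t (+ c)) (ℤP.≤-reflexive (sym x≡))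

scan-∷ʳ : ∀ B n {b xs} c → take (suc n) B ≡ xs ∷ʳ b
  → openScan (reverse (take (suc n) B)) c ≡ openScan (b ∷ reverse xs) c
scan-∷ʳ B n {b} {xs} c eq = cong (λ ys → openScan ys c) (trans (cong reverse eq) (LP.reverse-++ xs (b ∷ [])))

suc[i+n]≡i+[1+n] : ∀ t c → sucℤ (t +ℤ + c) ≡ t +ℤ + suc c
suc[i+n]≡i+[1+n] t c = shift t (+ c)
  where
  shift : ∀ t c → + 1 +ℤ (t +ℤ c) ≡ t +ℤ (+ 1 +ℤ c)
  shift = solve-∀

openScan-matching : ∀ B n c {t} → D B n ≡ t +ℤ + c → Matching B n t (openScan (reverse (take n B)) c)
openScan-matching B zero c {t} D≡ = record
  { q≤n   = z≤n
  ; above = λ { z≤n z≤n → i≡j+n⇒j≤i D≡ }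
  ; hit   = λ ()
  }
openScan-matching B (suc n) c {t} D≡ with next B n
... | end _ eq =
  subst (Matching B (suc n) t) (cong (λ xs → openScan (reverse xs) c) (sym eq))
    (matching-extend (openScan-matching B n c (trans (cong excess (sym eq)) D≡)) (i≡j+n⇒j≤i D≡))
... | bit false _ eq =
  subst (Matching B (suc n) t) (sym (scan-∷ʳ B n c eq))
    (matching-extend (openScan-matching B n (suc c) Dn≡) (i≡j+n⇒j≤i D≡))
  where
  Dn≡ : D B n ≡ t +ℤ + suc c
  Dn≡ = trans (excess-∷ʳ-false (take n B))
          (trans (cong (sucℤ ∘ excess) (sym eq)) (trans (cong sucℤ D≡) (suc[i+n]≡i+[1+n] t c)))
... | bit true n<len eq with c
...   | suc c′ =
  subst (Matching B (suc n) t) (sym (scan-∷ʳ B n (suc c′) eq))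
    (matching-extend (openScan-matching B n c′ Dn≡) (i≡j+n⇒j≤i D≡))
  where
  Dn≡ : D B n ≡ t +ℤ + c′
  Dn≡ = sucℤ-injective (trans (sym (excess-∷ʳ-true (take n B)))
          (trans (cong excess (sym eq)) (trans D≡ (sym (suc[i+n]≡i+[1+n] t c′)))))
...   | zero =
  subst (Matching B (suc n) t) (sym (trans (scan-∷ʳ B n 0 eq) (cong suc length≡n))) stop
  where
  length≡n : length (reverse (take n B)) ≡ n
  length≡n = trans (LP.length-reverse (take n B))
               (trans (LP.length-take n B) (ℕP.m≤n⇒m⊓n≡m (ℕP.<⇒≤ n<len)))
  D≡t : D B (suc n) ≡ t
  D≡t = trans D≡ (ℤP.+-identityʳ t)
  stop : Matching B (suc n) t (suc n)
  stop = record
    { q≤n   = ℕP.≤-refl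
    ; above = λ n<z z≤n → ℤP.≤-reflexive (sym (trans (cong (D B) (ℕP.≤-antisym z≤n n<z)) D≡t))
    ; hit   = λ { refl → trans (sym (trans (cong excess eq) (excess-∷ʳ-true (take n B)))) D≡t }
    }

select0-spec : ∀ B k → suc k ≤ rank0 B (length B)
  → ∃ λ p → select0 B (suc k) ≡ suc p × rank0 B p ≡ k × rank0 B (suc p) ≡ suc k
select0-spec []           k       ()
select0-spec (true ∷ bs)  k       k<r with select0-spec bs k k<r
... | p , sel , r , r′ = suc p , cong suc sel , r , r′
select0-spec (false ∷ bs) zero    _ = 0 , refl , refl , refl
select0-spec (false ∷ bs) (suc k) (s≤s k<r) with select0-spec bs k k<r
... | p , sel , r , r′ = suc p , cong suc sel , cong suc r , cong suc r′

rank0-level-set : ∀ B {k l r} → rank0 B l ≡ k → rank0 B (suc l) ≡ suc k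
  → rank0 B r ≡ suc k → rank0 B (suc r) ≡ suc (suc k)
  → ∀ q → (suc l ≤ q × q ≤ r) ⇔ rank0 B q ≡ suc k
rank0-level-set B rl rsl rr rsr q = mk⇔
  (λ (l<q , q≤r) → trans (rank0-constant B (trans rsl (sym rr)) l<q q≤r) rsl)
  (λ rq → rank0-cancel-< B (subst₂ _<_ (sym rl) (sym rq) ℕP.≤-refl)
        , ℕP.≤-pred (rank0-cancel-< B (subst₂ _<_ (sym rq) (sym rsr) ℕP.≤-refl)))

leftmostMin-<-from-pred : ∀ {f p b m} → LeftmostMin f (suc p) b m → f (suc p) <ℤ f p
  → ∀ {y} → p ≤ y → y < m → f m <ℤ f y
leftmostMin-<-from-pred lm fsp<fp {y} p≤y y<m with ℕP.m≤n⇒m<n∨m≡n p≤y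
... | inj₁ p<y  = <-before lm p<y y<m
... | inj₂ refl = ℤP.≤-<-trans (minimal lm ℕP.≤-refl (ℕP.≤-trans y<m (m≤b lm))) fsp<fp

-- In 1-based positions: B[p+1] = B[p′+1] = ')' and B[p+2 .. p′] are all '('.
module OpenInRun (B : List Bool) {p p′ b : ℕ}
  (p-closes : D B p ≡ sucℤ (D B (suc p))) (p′-closes : D B p′ ≡ sucℤ (D B (suc p′)))
  (ones : rank0 B (suc p) ≡ rank0 B p′) (p′<len : p′ < length B) (p<p′ : suc p ≤ p′) where

  module Landing {m′ : ℕ} (rmq : LeftmostMin (D B) (suc p′) b (suc m′)) where

    m : ℕ
    m = suc m′

    below : ∀ {y} → p′ ≤ y → y < m → D B m <ℤ D B y
    below = leftmostMin-<-from-pred rmq (subst (D B (suc p′) <ℤ_) (sym p′-closes) (i<suc[i] _))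

    p′≤m′ : p′ ≤ m′
    p′≤m′ = ℕP.≤-pred (a≤m rmq)

    Dm′≡ : D B m′ ≡ sucℤ (D B m)
    Dm′≡ = D-decrease B m′ (below p′≤m′ ℕP.≤-refl)

    above< : ∀ {q z} → Matching B m′ (D B m′) q → q ≤ z → z ≤ m′ → D B m <ℤ D B z
    above< M q≤z z≤m′ = ℤP.suc[i]≤j⇒i<j (subst (_≤ℤ _) Dm′≡ (above M q≤z z≤m′))

    hit≡ : ∀ {q′} → Matching B m′ (D B m′) (suc q′) → D B q′ ≡ D B m
    hit≡ M = sucℤ-injective (trans (hit M refl) Dm′≡)

    lands-before-p′ : ∀ {q} → Matching B m′ (D B m′) q → 0 < q → q ≤ p′
    lands-before-p′ {suc q′} M _ = ℕP.≰⇒> λ p′≤q′ →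
      ℤP.<-irrefl (sym (hit≡ M)) (below p′≤q′ (ℕP.m≤n⇒m≤1+n (q≤n M)))

    -- The level D B m is attained inside the run of '('s, and the scan cannot pass it.
    lands-in-run : ∀ {q} → Matching B m′ (D B m′) q → D B (suc p) ≤ℤ D B m → suc p ≤ q × q ≤ p′
    lands-in-run {q} M Ds≤Dm
      with D-intermediate-value B p<p′ Ds≤Dm (ℤP.<⇒≤ (below ℕP.≤-refl (s≤s p′≤m′)))
    ... | y , s≤y , y≤p′ , Dy≡Dm = ℕP.≤-trans s≤y (ℕP.<⇒≤ y<q) , lands-before-p′ M (ℕP.≤-<-trans z≤n y<q)
      where
      y<q : y < q
      y<q = ℕP.≰⇒> λ q≤y → ℤP.<-irrefl (sym Dy≡Dm) (above< M q≤y (ℕP.≤-trans y≤p′ p′≤m′))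

    landed-in-run : ∀ {q} → Matching B m′ (D B m′) q → suc p ≤ q → q ≤ p′ → D B (suc p) ≤ℤ D B m
    landed-in-run {suc q′} M (s≤s p≤q′) q≤p′ with ℕP.m≤n⇒m<n∨m≡n p≤q′
    ... | inj₂ refl = ℤP.≤-trans (ℤP.i≤suc[i] _) (ℤP.≤-reflexive (trans (sym p-closes) (hit≡ M)))
    ... | inj₁ p<q′ = ℤP.≤-trans (D-ascends-on-ones B ones (ℕP.<⇒≤ p′<len) p<q′ (ℕP.<⇒≤ q≤p′))
                                (ℤP.≤-reflexive (hit≡ M))

    scan : Matching B m′ (D B m′) (open′ B m)
    scan = openScan-matching B m′ 0 (sym (ℤP.+-identityʳ _))

  ≤-min⇔open′-in-run : ∀ {m} → LeftmostMin (D B) (suc p′) b m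
    → D B (suc p) ≤ℤ D B m ⇔ (suc p ≤ open′ B m × open′ B m ≤ p′)
  ≤-min⇔open′-in-run {zero} rmq with a≤m rmq
  ... | ()
  ≤-min⇔open′-in-run {suc m′} rmq =
    mk⇔ (lands-in-run scan) (λ (p<q , q≤p′) → landed-in-run scan p<q q≤p′)
    where open Landing rmq

≤-on-range⇔rank0-open′-rmqD : ∀ B (i j : ℕ) → 1 ≤ i → i < j → j ≤ rank0 B (length B)
  → ((∀ x → select0 B (suc i) ≤ x → x ≤ select0 B j → D B (select0 B i) ≤ℤ D B x)
     ⇔ (rank0 B (open′ B (rmqD B (select0 B (suc i)) (select0 B j))) ≡ i))
≤-on-range⇔rank0-open′-rmqD B (suc i) (suc j) (s≤s z≤n) i<j j≤r
  with select0-spec B i (ℕP.≤-trans (ℕP.<⇒≤ i<j) j≤r) | select0-spec B (suc i) (ℕP.≤-trans i<j j≤r)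
     | select0-spec B j j≤r
... | p , sel-p , r-p , r-sp | p′ , sel-p′ , r-p′ , r-sp′ | p″ , sel-p″ , _ , r-sp″
  rewrite sel-p | sel-p′ | sel-p″ =
  ⇔-trans (≤-min⇔≤-all rmq) (⇔-trans (≤-min⇔open′-in-run rmq) (rank0-level-set B r-p r-sp r-p′ r-sp′ _))
  where
  rmq : LeftmostMin (D B) (suc p′) (suc p″) (rmqD B (suc p′) (suc p″))
  rmq = rmqD-leftmostMin B (rank0-cancel-< B (subst₂ _<_ (sym r-p′) (sym r-sp″) i<j))
  p-closes : p < length B × D B p ≡ sucℤ (D B (suc p))
  p-closes = D-down B (trans r-sp (cong suc (sym r-p)))
  p′-closes : p′ < length B × D B p′ ≡ sucℤ (D B (suc p′))
  p′-closes = D-down B (trans r-sp′ (cong suc (sym r-p′)))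
  open OpenInRun B (proj₂ p-closes) (proj₂ p′-closes) (trans r-sp (sym r-p′)) (proj₁ p′-closes)
    (rank0-cancel-< B (subst₂ _<_ (sym r-p) (sym r-p′) ℕP.≤-refl))

lemma9 : (T : Tree) (i j : ℕ) → 1 ≤ i → i < j
         → j ≤ rank0 (DFUDS T) (length (DFUDS T))
         → ((∀ x → select0 (DFUDS T) (suc i) ≤ x → x ≤ select0 (DFUDS T) j
                  → D (DFUDS T) (select0 (DFUDS T) i) ≤ℤ D (DFUDS T) x)
            ⇔ (rank0 (DFUDS T) (open′ (DFUDS T) (rmqD (DFUDS T) (select0 (DFUDS T) (suc i)) (select0 (DFUDS T) j))) ≡ i))
lemma9 T = ≤-on-range⇔rank0-open′-rmqD (DFUDS T)
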